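{- In any bi-flock chicken graph, a prominent chicken in a flock that is not dominated by the other flock is a 3-Duke.
   Context: A bi-flock chicken graph is a finite orientation of a complete bipartite graph; vertices are chickens, the two partite sets are flocks, and "$c$ pecks $d$" means the edge is oriented from $c$ to $d$. A peck chain is a directed path. A chicken $d$ is a 3-Duke if every chicken not in the flock of $d$ can be reached from $d$ by a peck chain of length at most $3$. A chicken is prominent if it pecks at least as many chickens as any other chicken in its own flock. A flock $V_i$ dominates a flock $V_j$ if some chicken of $V_i$ pecks every chicken of $V_j$. -}

module Defs where

open import Data.Nat using (ℕ; zero; suc; _≤_)
open import Data.Fin using (Fin; inject₁; fromℕ)
open import Data.Bool using (Bool; true; false; not; T)
open import Data.Sum using (_⊎_; inj₁; inj₂)
open import Data.Product using (Σ; ∃; _×_; _,_)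
open import Data.Empty using (⊥)
open import Data.Unit using (⊤)
open import Data.List using (List; length; map; _++_; filterᵇ; allFin)
open import Data.Vec using (Vec; lookup)
open import Function.Definitions using (Injective)
open import Relation.Binary.PropositionalEquality using (_≡_)
open import Relation.Nullary using (¬_)

-- A bi-flock chicken graph: an orientation of the complete bipartite graph
-- K_{m,n}.  For a : Fin m, b : Fin n,
-- (o a b ≡ true) means a pecks b, (o a b ≡ false) means b pecks a.
BiFlock : ℕ → ℕ → Set
BiFlock m n = Fin m → Fin n → Bool

Chicken : ℕ → ℕ → Set
Chicken m n = Fin m ⊎ Fin n

module _ {m n : ℕ} (G : BiFlock m n) where

  pecksᵇ : Chicken m n → Chicken m n → Bool
  pecksᵇ (inj₁ a) (inj₂ b) = G a b
  pecksᵇ (inj₂ b) (inj₁ a) = not (G a b)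
  pecksᵇ (inj₁ _) (inj₁ _) = false
  pecksᵇ (inj₂ _) (inj₂ _) = false

  Pecks : Chicken m n → Chicken m n → Set
  Pecks c d = T (pecksᵇ c d)

  SameFlock : Chicken m n → Chicken m n → Set
  SameFlock (inj₁ _) (inj₁ _) = ⊤
  SameFlock (inj₂ _) (inj₂ _) = ⊤
  SameFlock (inj₁ _) (inj₂ _) = ⊥
  SameFlock (inj₂ _) (inj₁ _) = ⊥

  chickens : List (Chicken m n)
  chickens = map inj₁ (allFin m) ++ map inj₂ (allFin n)

  outdeg : Chicken m n → ℕ
  outdeg c = length (filterᵇ (pecksᵇ c) chickens)

  record PeckChain (c d : Chicken m n) (k : ℕ) : Set where
    field
      vertex   : Vec (Chicken m n) (suc k)
      start    : lookup vertex Fin.zero ≡ c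
      finish   : lookup vertex (fromℕ k) ≡ d
      steps    : (i : Fin k) → Pecks (lookup vertex (inject₁ i)) (lookup vertex (Fin.suc i))
      distinct : Injective _≡_ _≡_ (lookup vertex)

  ThreeDuke : Chicken m n → Set
  ThreeDuke d = (e : Chicken m n) → ¬ SameFlock d e →
                Σ ℕ (λ k → k ≤ 3 × PeckChain d e k)

  Prominent : Chicken m n → Set
  Prominent d = (c : Chicken m n) → SameFlock c d → outdeg c ≤ outdeg d

  DominatedBy : Chicken m n → Chicken m n → Set
  DominatedBy d e = ¬ SameFlock e d × ((x : Chicken m n) → SameFlock x d → Pecks e x)

  FlockDominated : Chicken m n → Set
  FlockDominated d = ∃ (λ e → DominatedBy d e)

module Submission where

open import Defs
open import Data.Nat using (ℕ; suc; _≤_; _<_; z≤n; s≤s)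
open import Data.Nat.Properties using (≤-refl; m≤n⇒m≤1+n; <⇒≱)
open import Data.Bool using (Bool; true; false; T; T?)
open import Data.Sum using (inj₁; inj₂)
open import Data.Product using (∃; _×_; _,_)
open import Data.Empty using (⊥-elim)
open import Data.Unit using (tt)
open import Data.Fin using (zero; suc; inject₁; fromℕ)
open import Data.Fin.Properties using (any?)
open import Data.List using (List; []; _∷_; map; filterᵇ; allFin; length)
open import Data.List.Membership.Propositional using (_∈_)
open import Data.List.Membership.Propositional.Properties using (∈-map⁺; ∈-++⁺ˡ; ∈-++⁺ʳ; ∈-allFin)
open import Data.List.Relation.Unary.Any using (here; there)
open import Data.Vec using (Vec; []; _∷_; lookup)
open import Data.Vec.Relation.Unary.All using ([]; _∷_)
open import Data.Vec.Relation.Unary.Unique.Propositional using (Unique; []; _∷_)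
open import Data.Vec.Relation.Unary.Unique.Propositional.Properties using (lookup-injective)
open import Relation.Binary.PropositionalEquality using (_≢_; refl)
open import Function using (_∘_)
open import Relation.Nullary using (¬_; Dec; yes; no)
open import Relation.Nullary.Decidable using (map′; _⊎-dec_; _×-dec_)

-- Let e be outside the flock of d.  If d does not peck e, then some a in the
-- flock of d pecks e, as otherwise e would dominate that flock.  Were there no
-- x with d → x → a, every chicken pecked by d would also be pecked by a; since
-- a pecks e and d does not, a would peck strictly more chickens than the
-- prominent d.  Hence d → x → a → e.

module _ {a} {A : Set a} {f g : A → Bool} (f⇒g : ∀ x → T (f x) → T (g x)) where

  length-filterᵇ-mono : (xs : List A) → length (filterᵇ f xs) ≤ length (filterᵇ g xs)
  length-filterᵇ-mono [] = z≤n
  length-filterᵇ-mono (x ∷ xs) with f x | g x | f⇒g x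
  ... | true  | true  | _   = s≤s (length-filterᵇ-mono xs)
  ... | true  | false | f⇒g = ⊥-elim (f⇒g tt)
  ... | false | true  | _   = m≤n⇒m≤1+n (length-filterᵇ-mono xs)
  ... | false | false | _   = length-filterᵇ-mono xs

  length-filterᵇ-< : ∀ {e} → ¬ T (f e) → T (g e) → (xs : List A) → e ∈ xs →
                     length (filterᵇ f xs) < length (filterᵇ g xs)
  length-filterᵇ-< {e} ¬fe ge (_ ∷ xs) (here refl) with f e | g e
  ... | true  | _    = ⊥-elim (¬fe tt)
  ... | false | true = s≤s (length-filterᵇ-mono xs)
  length-filterᵇ-< ¬fe ge (x ∷ xs) (there e∈xs) with f x | g x | f⇒g x
  ... | true  | true  | _   = s≤s (length-filterᵇ-< ¬fe ge xs e∈xs)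
  ... | true  | false | f⇒g = ⊥-elim (f⇒g tt)
  ... | false | true  | _   = m≤n⇒m≤1+n (length-filterᵇ-< ¬fe ge xs e∈xs)
  ... | false | false | _   = length-filterᵇ-< ¬fe ge xs e∈xs

module _ {m n : ℕ} (G : BiFlock m n) where

  sameFlock-refl : (c : Chicken m n) → SameFlock G c c
  sameFlock-refl (inj₁ _) = tt
  sameFlock-refl (inj₂ _) = tt

  sameFlock-sym : ∀ {c d} → SameFlock G c d → SameFlock G d c
  sameFlock-sym {inj₁ _} {inj₁ _} _ = tt
  sameFlock-sym {inj₂ _} {inj₂ _} _ = tt

  sameFlock-trans : ∀ {c d e} → SameFlock G c d → SameFlock G d e → SameFlock G c e
  sameFlock-trans {inj₁ _} {inj₁ _} {inj₁ _} _ _ = tt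
  sameFlock-trans {inj₂ _} {inj₂ _} {inj₂ _} _ _ = tt

  otherFlock-sym : ∀ {c d} → ¬ SameFlock G c d → ¬ SameFlock G d c
  otherFlock-sym c≁d = c≁d ∘ sameFlock-sym

  sameFlock-otherFlock : ∀ {c d e} → SameFlock G c d → ¬ SameFlock G d e → ¬ SameFlock G c e
  sameFlock-otherFlock c∼d d≁e c∼e = d≁e (sameFlock-trans (sameFlock-sym c∼d) c∼e)

  otherFlock-otherFlock : ∀ {c d e} → ¬ SameFlock G c d → ¬ SameFlock G d e → SameFlock G c e
  otherFlock-otherFlock {inj₁ _} {_}      {inj₁ _} _ _ = tt
  otherFlock-otherFlock {inj₂ _} {_}      {inj₂ _} _ _ = tt
  otherFlock-otherFlock {inj₁ _} {inj₁ _} {inj₂ _} c≁d _ = ⊥-elim (c≁d tt)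
  otherFlock-otherFlock {inj₁ _} {inj₂ _} {inj₂ _} _ d≁e = ⊥-elim (d≁e tt)
  otherFlock-otherFlock {inj₂ _} {inj₁ _} {inj₁ _} _ d≁e = ⊥-elim (d≁e tt)
  otherFlock-otherFlock {inj₂ _} {inj₂ _} {inj₁ _} c≁d _ = ⊥-elim (c≁d tt)

  sameFlock? : (c d : Chicken m n) → Dec (SameFlock G c d)
  sameFlock? (inj₁ _) (inj₁ _) = yes tt
  sameFlock? (inj₂ _) (inj₂ _) = yes tt
  sameFlock? (inj₁ _) (inj₂ _) = no λ ()
  sameFlock? (inj₂ _) (inj₁ _) = no λ ()

  any-chicken? : {P : Chicken m n → Set} → ((c : Chicken m n) → Dec (P c)) → Dec (∃ P)
  any-chicken? P? = map′ from to (any? (P? ∘ inj₁) ⊎-dec any? (P? ∘ inj₂))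
    where
      from = λ { (inj₁ (a , pa)) → inj₁ a , pa ; (inj₂ (b , pb)) → inj₂ b , pb }
      to   = λ { (inj₁ a , pa) → inj₁ (a , pa) ; (inj₂ b , pb) → inj₂ (b , pb) }

  ∈-chickens : (c : Chicken m n) → c ∈ chickens G
  ∈-chickens (inj₁ a) = ∈-++⁺ˡ (∈-map⁺ inj₁ (∈-allFin a))
  ∈-chickens (inj₂ b) = ∈-++⁺ʳ (map inj₁ (allFin m)) (∈-map⁺ inj₂ (∈-allFin b))

  pecks⇒otherFlock : ∀ {c d} → Pecks G c d → ¬ SameFlock G c d
  pecks⇒otherFlock {inj₁ _} {inj₂ _} _ ()
  pecks⇒otherFlock {inj₂ _} {inj₁ _} _ ()

  pecks⇒≢ : ∀ {c d} → Pecks G c d → c ≢ d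
  pecks⇒≢ {c} c→c refl = pecks⇒otherFlock c→c (sameFlock-refl c)

  pecked-by : ∀ {c d} → ¬ SameFlock G c d → ¬ Pecks G c d → Pecks G d c
  pecked-by {inj₁ _} {inj₁ _} c≁d _ = ⊥-elim (c≁d tt)
  pecked-by {inj₂ _} {inj₂ _} c≁d _ = ⊥-elim (c≁d tt)
  pecked-by {inj₁ a} {inj₂ b} _ c↛d with G a b
  ... | true  = ⊥-elim (c↛d tt)
  ... | false = tt
  pecked-by {inj₂ b} {inj₁ a} _ c↛d with G a b
  ... | true  = tt
  ... | false = ⊥-elim (c↛d tt)

  peckChain : ∀ {k} (v : Vec (Chicken m n) (suc k)) → Unique v →
              (∀ i → Pecks G (lookup v (inject₁ i)) (lookup v (suc i))) →
              PeckChain G (lookup v zero) (lookup v (fromℕ k)) k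
  peckChain v v-unique steps = record
    { vertex   = v
    ; start    = refl
    ; finish   = refl
    ; steps    = steps
    ; distinct = λ {i} {j} → lookup-injective v-unique i j
    }

  peckChain₁ : ∀ {c d} → Pecks G c d → PeckChain G c d 1
  peckChain₁ {c} {d} c→d =
    peckChain (c ∷ d ∷ []) ((pecks⇒≢ c→d ∷ []) ∷ [] ∷ []) λ { zero → c→d }

  peckChain₃ : ∀ {c x a e} → Pecks G c x → Pecks G x a → Pecks G a e → ¬ Pecks G c e →
               PeckChain G c e 3
  peckChain₃ {c} {x} {a} {e} c→x x→a a→e c↛e =
    peckChain (c ∷ x ∷ a ∷ e ∷ [])
      ((pecks⇒≢ c→x ∷ c≢a ∷ c≢e ∷ []) ∷ (pecks⇒≢ x→a ∷ x≢e ∷ []) ∷ (pecks⇒≢ a→e ∷ []) ∷ [] ∷ [])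
      λ { zero → c→x ; (suc zero) → x→a ; (suc (suc zero)) → a→e }
    where
      c≢a : c ≢ a
      c≢a refl = c↛e a→e
      x≢e : x ≢ e
      x≢e refl = c↛e c→x
      c≁e : ¬ SameFlock G c e
      c≁e = sameFlock-otherFlock
              (otherFlock-otherFlock (pecks⇒otherFlock c→x) (pecks⇒otherFlock x→a))
              (pecks⇒otherFlock a→e)
      c≢e : c ≢ e
      c≢e refl = c≁e (sameFlock-refl c)

  outdeg-< : ∀ {d a e} → (∀ x → Pecks G d x → Pecks G a x) → ¬ Pecks G d e → Pecks G a e →
             outdeg G d < outdeg G a
  outdeg-< {e = e} d⇒a d↛e a→e = length-filterᵇ-< d⇒a d↛e a→e (chickens G) (∈-chickens e)

  undominated⇒attacker : ∀ {d e} → ¬ FlockDominated G d → ¬ SameFlock G d e →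
                         ∃ λ a → SameFlock G a d × Pecks G a e
  undominated⇒attacker {d} {e} undominated d≁e
    with any-chicken? (λ a → sameFlock? a d ×-dec T? (pecksᵇ G a e))
  ... | yes attacker = attacker
  ... | no ¬attacker = ⊥-elim (undominated (e , otherFlock-sym d≁e , e-pecks-flock))
    where
      e-pecks-flock : ∀ x → SameFlock G x d → Pecks G e x
      e-pecks-flock x x∼d =
        pecked-by (sameFlock-otherFlock x∼d d≁e) (λ x→e → ¬attacker (x , x∼d , x→e))

  prominent⇒two-step-path : ∀ {d a e} → Prominent G d → SameFlock G a d → Pecks G a e → ¬ Pecks G d e →
                      ∃ λ x → Pecks G d x × Pecks G x a
  prominent⇒two-step-path {d} {a} {e} prominent a∼d a→e d↛e
    with any-chicken? (λ x → T? (pecksᵇ G d x) ×-dec T? (pecksᵇ G x a))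
  ... | yes path = path
  ... | no ¬path = ⊥-elim (<⇒≱ (outdeg-< {d} {a} {e} d⇒a d↛e a→e) (prominent a a∼d))
    where
      d⇒a : ∀ x → Pecks G d x → Pecks G a x
      d⇒a x d→x = pecked-by (otherFlock-sym (sameFlock-otherFlock a∼d (pecks⇒otherFlock d→x)))
                            (λ x→a → ¬path (x , d→x , x→a))

lemma2 : (m n : ℕ) (G : BiFlock m n) (d : Chicken m n) →
         Prominent G d → ¬ FlockDominated G d → ThreeDuke G d
lemma2 m n G d prominent undominated e d≁e with T? (pecksᵇ G d e)
... | yes d→e = 1 , s≤s z≤n , peckChain₁ G d→e
... | no d↛e
  with a , a∼d , a→e ← undominated⇒attacker G undominated d≁e
  with x , d→x , x→a ← prominent⇒two-step-path G prominent a∼d a→e d↛e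
  = 3 , ≤-refl , peckChain₃ G d→x x→a a→e d↛e
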